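{- If $a,b,k\in\mathbb{N}$ satisfy $k\le\min(a,b)$, then $(\mathcal{A}_k([a]\times[b]),\le_k)\cong \mathcal{C}(a,k)\times\mathcal{C}(b,k)$ as posets.
   Context: $\mathbb{N}$ denotes the nonnegative integers and $[n]=\{1,\dots,n\}$ with its natural order; $[a]\times[b]$ has the product order. For a finite poset $P$, $\mathcal{A}_k(P)$ is the set of antichains of $P$ of cardinality $k$; for $A,B\in\mathcal{A}_k(P)$ write $A\prec_k B$ if $A\setminus B=\{a\}$ and $B\setminus A=\{b\}$ are singletons with $a<_P b$, and $\le_k$ is the reflexive transitive closure of $\prec_k$. For $k\le n$, $\mathcal{C}(n,k)$ is the set of $k$-subsets of $[n]$, each written as an increasing sequence $(x_1<\dots<x_k)$, ordered by $\mathbf{x}\le\mathbf{y}$ iff $x_i\le y_i$ for all $i$. Products of posets carry the componentwise order. -}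

module Defs where

open import Data.Nat using (ℕ)
open import Data.Fin using (Fin) renaming (_≤_ to _≤ᶠ_; _<_ to _<ᶠ_)
open import Data.Fin.Subset using (Subset; ∣_∣; _∈_; _∉_)
open import Data.Vec using (Vec; lookup; map; sum)
open import Data.Product using (Σ; ∃; ∃-syntax; _×_; _,_; proj₁; proj₂)
open import Relation.Binary.PropositionalEquality using (_≡_; _≢_)
open import Relation.Binary.Construct.Closure.ReflexiveTransitive using (Star)
open import Function.Bundles using (_⇔_; _↔_; Inverse)

-- The poset [a] × [b] (with [n] modelled by Fin n, order-isomorphic to {1..n}).
Elem : ℕ → ℕ → Set
Elem a b = Fin a × Fin b

_≤P_ : ∀ {a b} → Elem a b → Elem a b → Set
(i , j) ≤P (i' , j') = (i ≤ᶠ i') × (j ≤ᶠ j')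

_<P_ : ∀ {a b} → Elem a b → Elem a b → Set
x <P y = (x ≤P y) × (x ≢ y)

-- Subsets of [a] × [b]: one row (a subset of Fin b) for each i : Fin a.
Grid : ℕ → ℕ → Set
Grid a b = Vec (Subset b) a

_∈G_ : ∀ {a b} → Elem a b → Grid a b → Set
(i , j) ∈G S = j ∈ lookup S i

_∉G_ : ∀ {a b} → Elem a b → Grid a b → Set
(i , j) ∉G S = j ∉ lookup S i

card : ∀ {a b} → Grid a b → ℕ
card S = sum (map ∣_∣ S)

IsAntichain : ∀ {a b} → Grid a b → Set
IsAntichain S = ∀ x y → x ∈G S → y ∈G S → x ≤P y → x ≡ y

-- 𝒜_k([a]×[b]): antichains of cardinality k.  Proof fields are irrelevant,
-- so an antichain is determined by its underlying subset.
record Antichain (k a b : ℕ) : Set where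
  constructor mkAC
  field
    set  : Grid a b
    .anti : IsAntichain set
    .size : card set ≡ k
open Antichain public

_≺_ : ∀ {k a b} → Antichain k a b → Antichain k a b → Set
_≺_ {a = a} {b = b} A B =
  Σ (Elem a b) λ p → Σ (Elem a b) λ q → (p <P q)
    × (∀ x → ((x ∈G set A) × (x ∉G set B)) ⇔ (x ≡ p))
    × (∀ x → ((x ∈G set B) × (x ∉G set A)) ⇔ (x ≡ q))

_≤A_ : ∀ {k a b} → Antichain k a b → Antichain k a b → Set
_≤A_ = Star _≺_

-- 𝒞(n,k): k-subsets of [n] as strictly increasing sequences.
record Comb (n k : ℕ) : Set where
  constructor mkC
  field
    seq : Vec (Fin n) k
    .incr : ∀ (i j : Fin k) → i <ᶠ j → lookup seq i <ᶠ lookup seq j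
open Comb public

_≤C_ : ∀ {n k} → Comb n k → Comb n k → Set
x ≤C y = ∀ i → lookup (seq x) i ≤ᶠ lookup (seq y) i

_≤CC_ : ∀ {a b k} → Comb a k × Comb b k → Comb a k × Comb b k → Set
(x , y) ≤CC (x' , y') = (x ≤C x') × (y ≤C y')

OrderIso : (A B : Set) → (A → A → Set) → (B → B → Set) → Set
OrderIso A B _≤₁_ _≤₂_ =
  Σ (A ↔ B) λ e → ∀ x y → (x ≤₁ y) ⇔ (Inverse.to e x ≤₂ Inverse.to e y)

-- Sort the points of an antichain of [a] × [b] by row: the rows then increase and the columns
-- decrease strictly, so the antichain is a staircase whose rows and (reversed) columns form a
-- pair of k-combinations, and any such pair zips back to a staircase. A move A ≺ B replaces a
-- point p by some q > p; no point of the staircase lies between p and q in the staircase order,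
-- so q takes the place of p and the sorted list rises pointwise. Conversely a staircase lying
-- pointwise below another reaches it by moves that each raise one coordinate of one point.
-- Hence ≤_k is the pointwise order of staircases, i.e. the product order of combinations.

module Submission where

open import Defs
open import Data.Nat using (ℕ; _≤_)
open import Data.Product using (_×_)

open import Data.Nat as ℕ using (zero; suc; _+_; _<_)
import Data.Nat.Properties as ℕP
open import Data.Fin as Fin using (Fin; zero; suc; toℕ)
import Data.Fin.Properties as FinP
open import Data.Fin.Subset using (Subset; ∣_∣; inside; outside) renaming (_∈_ to _∈ˢ_)
import Data.Fin.Subset.Properties as SubsetP
open import Data.Vec as Vec using (Vec; []; _∷_; lookup; tabulate; toList)
import Data.Vec.Properties as VecP
import Data.Vec.Relation.Unary.All.Properties as VecAllP
open import Data.List using (List; []; _∷_; map; length; reverse; zip; unzip; _++_)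
import Data.List.Properties as ListP
open import Data.List.Relation.Unary.All as All using (All; []; _∷_)
import Data.List.Relation.Unary.Any as Any
import Data.List.Relation.Unary.Any.Properties as AnyP
import Data.List.Relation.Unary.All.Properties as AllP
open import Data.List.Relation.Unary.AllPairs as AllPairs using (AllPairs; []; _∷_)
import Data.List.Relation.Unary.AllPairs.Properties as AllPairsP
open import Data.List.Relation.Binary.Pointwise as Pointwise using (Pointwise; []; _∷_)
import Data.List.Relation.Binary.Pointwise.Properties as PointwiseP
open import Data.List.Membership.Propositional using (_∈_; _∉_)
open import Data.List.Membership.Propositional.Properties
  using (∈-map⁺; ∈-map⁻; ∈-++⁺ˡ; ∈-++⁺ʳ; ∈-++⁻)
open import Data.List.Relation.Unary.Any using (here; there)
open import Data.Product as Product using (∃₂; ∃-syntax; _,_; proj₁; proj₂)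
import Data.Product.Relation.Binary.Pointwise.NonDependent as ×
import Data.Product.Properties as ProductP
open import Data.Product.Relation.Binary.Lex.Strict using (×-Lex)
open import Data.Product.Function.NonDependent.Propositional using (_×-⇔_)
open import Data.Sum as Sum using (_⊎_; inj₁; inj₂; [_,_]′)
open import Data.Empty using (⊥-elim)
open import Function using (id; _∘_; flip)
open import Function.Bundles using (_⇔_; mk⇔; mk↔ₛ′; Equivalence)
open import Function.Properties.Equivalence using () renaming (sym to ⇔-sym; trans to ⇔-trans)
open import Relation.Binary using (Rel; Reflexive; Transitive; Irreflexive; DecidableEquality)
open import Relation.Binary.PropositionalEquality
open import Relation.Binary.Construct.Closure.ReflexiveTransitive using (ε; _◅_)
open import Relation.Nullary using (¬_; Dec; yes; no; does; _×-dec_)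
open import Relation.Nullary.Decidable using (dec-true; recompute)

private
  variable
    A B : Set
    R : A → A → Set
    x y p q : A
    xs ys : List A
    n k : ℕ

module _ {_<_ : A → A → Set} (<-trans : Transitive _<_) (<-irrefl : Irreflexive _≡_ _<_) where

  private
    head-or-above : All (x <_) xs → y ∈ x ∷ xs → y ≡ x ⊎ x < y
    head-or-above x<xs (here y≡x) = inj₁ y≡x
    head-or-above x<xs (there y∈xs) = inj₂ (All.lookup x<xs y∈xs)

    ∈-tail : All (x <_) xs → (∀ {z} → z ∈ x ∷ xs → z ∈ x ∷ ys) → ∀ {z} → z ∈ xs → z ∈ ys
    ∈-tail x<xs xs⊆ys z∈xs with xs⊆ys (there z∈xs)
    ... | here refl = ⊥-elim (<-irrefl refl (All.lookup x<xs z∈xs))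
    ... | there z∈ys = z∈ys

  AllPairs-≡ : AllPairs _<_ xs → AllPairs _<_ ys →
               (∀ {z} → z ∈ xs → z ∈ ys) → (∀ {z} → z ∈ ys → z ∈ xs) → xs ≡ ys
  AllPairs-≡ [] [] _ _ = refl
  AllPairs-≡ [] (_ ∷ _) _ ys⊆xs with ys⊆xs (here refl)
  ... | ()
  AllPairs-≡ (_ ∷ _) [] xs⊆ys _ with xs⊆ys (here refl)
  ... | ()
  AllPairs-≡ {x ∷ xs} (x<xs ∷ sxs) (y<ys ∷ sys) xs⊆ys ys⊆xs
    with head-or-above y<ys (xs⊆ys (here refl)) | head-or-above x<xs (ys⊆xs (here refl))
  ... | inj₁ refl | _ = cong (x ∷_) (AllPairs-≡ sxs sys (∈-tail x<xs xs⊆ys) (∈-tail y<ys ys⊆xs))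
  ... | inj₂ y<x | inj₁ refl = ⊥-elim (<-irrefl refl y<x)
  ... | inj₂ y<x | inj₂ x<y = ⊥-elim (<-irrefl refl (<-trans x<y y<x))

AllPairs-reverse⁺ : AllPairs (flip R) xs → AllPairs R (reverse xs)
AllPairs-reverse⁺ [] = []
AllPairs-reverse⁺ {R = R} {x ∷ xs} (x>xs ∷ s) =
  subst (AllPairs R) (sym (ListP.unfold-reverse x xs))
    (AllPairsP.++⁺ (AllPairs-reverse⁺ s) ([] ∷ [])
      (All.tabulate (λ y∈ → All.lookup x>xs (AnyP.reverse⁻ y∈) ∷ [])))

AllPairs-map-∈ : {S : A → A → Set} → (∀ {x y} → x ∈ xs → y ∈ xs → R x y → S x y) →
                 AllPairs R xs → AllPairs S xs
AllPairs-map-∈ R⇒S [] = []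
AllPairs-map-∈ R⇒S (x<xs ∷ s) =
  All.tabulate (λ y∈xs → R⇒S (here refl) (there y∈xs) (All.lookup x<xs y∈xs))
  ∷ AllPairs-map-∈ (λ x∈ y∈ → R⇒S (there x∈) (there y∈)) s

All-between : ∀ {P Q T : A → Set} {us vs ws} →
              (∀ {u v w} → R u v → R v w → P u → Q w → T v) →
              Pointwise R us vs → Pointwise R vs ws → All P us → All Q ws → All T vs
All-between between [] [] [] [] = []
All-between between (r ∷ rs) (r' ∷ rs') (pu ∷ pus) (qw ∷ qws) =
  between r r' pu qw ∷ All-between between rs rs' pus qws

module _ {R : A → A → Set} {S : B → B → Set} where

  Pointwise-×⇔ : ∀ {us vs} →
    Pointwise (×.Pointwise R S) us vs ⇔
    (Pointwise R (map proj₁ us) (map proj₁ vs) × Pointwise S (map proj₂ us) (map proj₂ vs))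
  Pointwise-×⇔ = mk⇔ (λ rs → Pointwise.map⁺ proj₁ proj₁ (Pointwise.map proj₁ rs)
                           , Pointwise.map⁺ proj₂ proj₂ (Pointwise.map proj₂ rs))
                     (Product.uncurry unsplit)
    where
    unsplit : ∀ {us vs} → Pointwise R (map proj₁ us) (map proj₁ vs) →
              Pointwise S (map proj₂ us) (map proj₂ vs) → Pointwise (×.Pointwise R S) us vs
    unsplit {[]} {[]} [] [] = []
    unsplit {_ ∷ _} {_ ∷ _} (r ∷ rs) (s ∷ ss) = (r , s) ∷ unsplit rs ss

  AllPairs-×⇔ : ∀ {us} →
    AllPairs (×.Pointwise R S) us ⇔ (AllPairs R (map proj₁ us) × AllPairs S (map proj₂ us))
  AllPairs-×⇔ = mk⇔ (λ rs → AllPairsP.map⁺ (AllPairs.map proj₁ rs)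
                          , AllPairsP.map⁺ (AllPairs.map proj₂ rs))
                    (Product.uncurry (unsplit _))
    where
    unsplit : ∀ us → AllPairs R (map proj₁ us) → AllPairs S (map proj₂ us) → AllPairs (×.Pointwise R S) us
    unsplit [] [] [] = []
    unsplit (_ ∷ us) (r ∷ rs) (s ∷ ss) = All.zip (AllP.map⁻ r , AllP.map⁻ s) ∷ unsplit us rs ss

Pointwise-reverse⇔ : Pointwise R (reverse xs) (reverse ys) ⇔ Pointwise R xs ys
Pointwise-reverse⇔ {R = R} {xs = xs} {ys} = mk⇔
  (subst₂ (Pointwise R) (ListP.reverse-involutive xs) (ListP.reverse-involutive ys) ∘ Pointwise.reverse⁺)
  Pointwise.reverse⁺

unzip≡map-proj : (us : List (A × B)) → unzip us ≡ (map proj₁ us , map proj₂ us)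
unzip≡map-proj [] = refl
unzip≡map-proj (u ∷ us) = cong (Product.zip _∷_ _∷_ u) (unzip≡map-proj us)

zip-map-proj : (us : List (A × B)) → zip (map proj₁ us) (map proj₂ us) ≡ us
zip-map-proj us = trans (cong (Product.uncurry zip) (sym (unzip≡map-proj us))) (ListP.zip-unzip us)

map-proj-zip : (xs : List A) (ys : List B) → length xs ≡ length ys →
               map proj₁ (zip xs ys) ≡ xs × map proj₂ (zip xs ys) ≡ ys
map-proj-zip xs ys eq with trans (sym (unzip≡map-proj (zip xs ys))) (ListP.unzip-zip xs ys eq)
... | eq' = cong proj₁ eq' , cong proj₂ eq'

module _ {R : A → A → Set} where

  Pointwise-toList⇔ : (v w : Vec A n) →
    (∀ i → R (lookup v i) (lookup w i)) ⇔ Pointwise R (toList v) (toList w)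
  Pointwise-toList⇔ v w = mk⇔ (to v w) (from v w)
    where
    to : (v w : Vec A n) → (∀ i → R (lookup v i) (lookup w i)) → Pointwise R (toList v) (toList w)
    to [] [] _ = []
    to (_ ∷ v) (_ ∷ w) Rvw = Rvw zero ∷ to v w (Rvw ∘ suc)
    from : (v w : Vec A n) → Pointwise R (toList v) (toList w) → ∀ i → R (lookup v i) (lookup w i)
    from (_ ∷ _) (_ ∷ _) (r ∷ _) zero = r
    from (_ ∷ v) (_ ∷ w) (_ ∷ rs) (suc i) = from v w rs i

  AllPairs-toList⇔ : (v : Vec A n) →
    (∀ i j → i Fin.< j → R (lookup v i) (lookup v j)) ⇔ AllPairs R (toList v)
  AllPairs-toList⇔ v = mk⇔ (to v) (from v)
    where
    to : (v : Vec A n) → (∀ i j → i Fin.< j → R (lookup v i) (lookup v j)) → AllPairs R (toList v)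
    to [] _ = []
    to (_ ∷ v) incr =
      VecAllP.toList⁺ (VecAllP.lookup⁻ (λ j → incr zero (suc j) (ℕ.s≤s ℕ.z≤n)))
      ∷ to v (λ i j i<j → incr (suc i) (suc j) (ℕ.s≤s i<j))
    from : (v : Vec A n) → AllPairs R (toList v) → ∀ i j → i Fin.< j → R (lookup v i) (lookup v j)
    from (_ ∷ v) (x<v ∷ _) zero (suc j) _ = VecAllP.lookup⁺ (VecAllP.toList⁻ x<v) j
    from (_ ∷ v) (_ ∷ s) (suc i) (suc j) (ℕ.s≤s i<j) = from v s i j i<j

data Replace {A : Set} : List A → List A → A → A → Set where
  here : ∀ {p q xs} → Replace (p ∷ xs) (q ∷ xs) p q
  _∷_  : ∀ {p q xs ys} x → Replace xs ys p q → Replace (x ∷ xs) (x ∷ ys) p q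

replace : p ∈ xs → ∀ q → ∃[ ys ] Replace xs ys p q
replace (here refl) q = _ , here
replace {xs = x ∷ _} (there p∈xs) q = Product.map (x ∷_) (x ∷_) (replace p∈xs q)

Replace-sym : Replace xs ys p q → Replace ys xs q p
Replace-sym here = here
Replace-sym (x ∷ r) = x ∷ Replace-sym r

Replace-∈ : Replace xs ys p q → p ∈ xs
Replace-∈ here = here refl
Replace-∈ (x ∷ r) = there (Replace-∈ r)

∈-Replace : Replace xs ys p q → y ∈ xs → y ≡ p ⊎ y ∈ ys
∈-Replace here (here y≡p) = inj₁ y≡p
∈-Replace here (there y∈xs) = inj₂ (there y∈xs)
∈-Replace (x ∷ r) (here y≡x) = inj₂ (here y≡x)
∈-Replace (x ∷ r) (there y∈xs) = Sum.map₂ there (∈-Replace r y∈xs)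

Replace-length : Replace xs ys p q → length xs ≡ length ys
Replace-length here = refl
Replace-length (x ∷ r) = cong suc (Replace-length r)

Replace-pointwise : Reflexive R → R p q → Replace xs ys p q → Pointwise R xs ys
Replace-pointwise refl-R Rpq here = Rpq ∷ PointwiseP.refl refl-R
Replace-pointwise refl-R Rpq (x ∷ r) = refl-R ∷ Replace-pointwise refl-R Rpq r

Replace-∉ : Irreflexive _≡_ R → AllPairs R xs → p ≢ q → Replace xs ys p q → p ∉ ys
Replace-∉ irrefl _ p≢q here (here p≡q) = p≢q p≡q
Replace-∉ irrefl (p<xs ∷ _) p≢q here (there p∈xs) = irrefl refl (All.lookup p<xs p∈xs)
Replace-∉ irrefl (x<xs ∷ _) p≢q (x ∷ r) (here refl) = irrefl refl (All.lookup x<xs (Replace-∈ r))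
Replace-∉ irrefl (_ ∷ s) p≢q (x ∷ r) (there p∈ys) = Replace-∉ irrefl s p≢q r p∈ys

Replace-AllPairs : (∀ {x} → x ∈ xs → R x p → R x q) → (∀ {x} → x ∈ xs → R p x → R q x) →
                   Replace xs ys p q → AllPairs R xs → AllPairs R ys
Replace-AllPairs below above here (p<xs ∷ s) =
  All.tabulate (λ x∈xs → above (there x∈xs) (All.lookup p<xs x∈xs)) ∷ s
Replace-AllPairs below above (x ∷ r) (x<xs ∷ s) =
  All.tabulate (λ y∈ys → [ (λ { refl → below (here refl) (All.lookup x<xs (Replace-∈ r)) })
                         , All.lookup x<xs ]′ (∈-Replace (Replace-sym r) y∈ys))
  ∷ Replace-AllPairs (below ∘ there) (above ∘ there) r s

-- A ≺ B unfolds to p <P q × Exchange (_∈G set A) (_∈G set B) p q.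
Exchange : (P Q : A → Set) → A → A → Set
Exchange P Q p q = (∀ x → (P x × ¬ Q x) ⇔ (x ≡ p)) × (∀ x → (Q x × ¬ P x) ⇔ (x ≡ q))

Exchange-resp : ∀ {P Q P' Q' : A → Set} → (∀ x → P x ⇔ P' x) → (∀ x → Q x ⇔ Q' x) →
                Exchange P Q p q → Exchange P' Q' p q
Exchange-resp P⇔P' Q⇔Q' (out , in') =
  (λ x → transport (P⇔P' x) (Q⇔Q' x) (out x)) , (λ x → transport (Q⇔Q' x) (P⇔P' x) (in' x))
  where
  open Equivalence
  transport : ∀ {U U' V V' W : Set} → U ⇔ U' → V ⇔ V' → (U × ¬ V) ⇔ W → (U' × ¬ V') ⇔ W
  transport U⇔U' V⇔V' e =
    mk⇔ (λ (u' , ¬v') → to e (from U⇔U' u' , ¬v' ∘ to V⇔V'))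
        (λ w → let (u , ¬v) = from e w in to U⇔U' u , ¬v ∘ from V⇔V')

Replace-Exchange : p ∉ ys → q ∉ xs → Replace xs ys p q → Exchange (_∈ xs) (_∈ ys) p q
Replace-Exchange p∉ys q∉xs r = exchanged p∉ys r , exchanged q∉xs (Replace-sym r)
  where
  exchanged : ∀ {xs ys p q} → p ∉ ys → Replace xs ys p q → ∀ x → (x ∈ xs × x ∉ ys) ⇔ (x ≡ p)
  exchanged p∉ys r x = mk⇔ (λ (x∈xs , x∉ys) → [ id , ⊥-elim ∘ x∉ys ]′ (∈-Replace r x∈xs))
                           (λ { refl → Replace-∈ r , p∉ys })

Exchange-⊆ : {xs ys : List A} {p q : A} → DecidableEquality A →
             Exchange (_∈ xs) (_∈ ys) p q → ∀ {x} → x ∈ xs → x ≢ p → x ∈ ys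
Exchange-⊆ {ys = ys} _≟_ (out , _) {x} x∈xs x≢p with Any.any? (x ≟_) ys
... | yes x∈ys = x∈ys
... | no x∉ys = ⊥-elim (x≢p (Equivalence.to (out x) (x∈xs , x∉ys)))

-- Staircases

private
  variable
    a b : ℕ
    l l' : List (Elem a b)

_⋖_ : Rel (Elem a b) _
x ⋖ y = (proj₁ x Fin.< proj₁ y) × (proj₂ y Fin.< proj₂ x)

Sorted : List (Elem a b) → Set
Sorted = AllPairs _⋖_

⋖-trans : Transitive (_⋖_ {a} {b})
⋖-trans (i<i' , j'<j) (i'<i'' , j''<j') = FinP.<-trans i<i' i'<i'' , FinP.<-trans j''<j' j'<j

⋖-irrefl : Irreflexive _≡_ (_⋖_ {a} {b})
⋖-irrefl refl (i<i , _) = FinP.<-irrefl refl i<i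

_⋖?_ : (x y : Elem a b) → Dec (x ⋖ y)
x ⋖? y = (proj₁ x Fin.<? proj₁ y) ×-dec (proj₂ y Fin.<? proj₂ x)

_≟ᴱ_ : DecidableEquality (Elem a b)
_≟ᴱ_ = ProductP.≡-dec FinP._≟_ FinP._≟_

≤P-refl : Reflexive (_≤P_ {a} {b})
≤P-refl = FinP.≤-refl , FinP.≤-refl

≤P-trans : Transitive (_≤P_ {a} {b})
≤P-trans (i≤i' , j≤j') (i'≤i'' , j'≤j'') = FinP.≤-trans i≤i' i'≤i'' , FinP.≤-trans j≤j' j'≤j''

Sorted-trichotomous : Sorted l → x ∈ l → y ∈ l → x ≡ y ⊎ x ⋖ y ⊎ y ⋖ x
Sorted-trichotomous (_ ∷ _) (here refl) (here refl) = inj₁ refl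
Sorted-trichotomous (x⋖l ∷ _) (here refl) (there y∈l) = inj₂ (inj₁ (All.lookup x⋖l y∈l))
Sorted-trichotomous (y⋖l ∷ _) (there x∈l) (here refl) = inj₂ (inj₂ (All.lookup y⋖l x∈l))
Sorted-trichotomous (_ ∷ s) (there x∈l) (there y∈l) = Sorted-trichotomous s x∈l y∈l

⋖-below-moved : Sorted l → x ∈ l → q ∈ l → x ≢ q → p ≤P q → x ⋖ p → x ⋖ q
⋖-below-moved s x∈l q∈l x≢q (p₁≤q₁ , _) (x₁<p₁ , _) with Sorted-trichotomous s x∈l q∈l
... | inj₁ x≡q = ⊥-elim (x≢q x≡q)
... | inj₂ (inj₁ x⋖q) = x⋖q
... | inj₂ (inj₂ (q₁<x₁ , _)) = ⊥-elim (ℕP.<⇒≱ (ℕP.<-trans q₁<x₁ x₁<p₁) p₁≤q₁)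

⋖-above-moved : Sorted l → x ∈ l → q ∈ l → x ≢ q → p ≤P q → p ⋖ x → q ⋖ x
⋖-above-moved s x∈l q∈l x≢q (_ , p₂≤q₂) (_ , x₂<p₂) with Sorted-trichotomous s x∈l q∈l
... | inj₁ x≡q = ⊥-elim (x≢q x≡q)
... | inj₂ (inj₁ (_ , q₂<x₂)) = ⊥-elim (ℕP.<⇒≱ (ℕP.<-trans q₂<x₂ x₂<p₂) p₂≤q₂)
... | inj₂ (inj₂ q⋖x) = q⋖x

-- Exchanging p for a larger q keeps its position: nothing of a staircase lies strictly between them.
Exchange⇒Replace : Sorted l → Sorted l' → p <P q → Exchange (_∈ l) (_∈ l') p q → Replace l l' p q
Exchange⇒Replace {l = l} {l'} {p = p} {q} s s' (p≤q , p≢q) ex@(out , in') =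
  subst (λ m → Replace l m p q) (AllPairs-≡ ⋖-trans ⋖-irrefl m-sorted s' m⊆l' l'⊆m) r
  where
  open Equivalence
  p∈l = proj₁ (from (out p) refl)
  p∉l' = proj₂ (from (out p) refl)
  q∈l' = proj₁ (from (in' q) refl)
  q∉l = proj₂ (from (in' q) refl)
  l⊆l' = Exchange-⊆ _≟ᴱ_ ex
  l'⊆l = Exchange-⊆ _≟ᴱ_ (Product.swap ex)
  r = proj₂ (replace p∈l q)
  x≢q : ∀ {x} → x ∈ l → x ≢ q
  x≢q x∈l refl = q∉l x∈l
  m-sorted = Replace-AllPairs
    (λ x∈l x⋖p → ⋖-below-moved s' (l⊆l' x∈l (λ x≡p → ⋖-irrefl x≡p x⋖p)) q∈l' (x≢q x∈l)
                                 p≤q x⋖p)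
    (λ x∈l p⋖x → ⋖-above-moved s' (l⊆l' x∈l (λ x≡p → ⋖-irrefl (sym x≡p) p⋖x)) q∈l' (x≢q x∈l)
                                 p≤q p⋖x)
    r s
  m⊆l' : ∀ {z} → z ∈ proj₁ (replace p∈l q) → z ∈ l'
  m⊆l' z∈m with ∈-Replace (Replace-sym r) z∈m
  ... | inj₁ refl = q∈l'
  ... | inj₂ z∈l = l⊆l' z∈l (λ { refl → Replace-∉ ⋖-irrefl s p≢q r z∈m })
  l'⊆m : ∀ {z} → z ∈ l' → z ∈ proj₁ (replace p∈l q)
  l'⊆m {z} z∈l' with z ≟ᴱ q
  ... | yes refl = Replace-∈ (Replace-sym r)
  ... | no z≢q with ∈-Replace r (l'⊆l z∈l' z≢q)
  ...   | inj₁ refl = ⊥-elim (p∉l' z∈l')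
  ...   | inj₂ z∈m = z∈m

members : Subset n → List (Fin n)
members [] = []
members (inside ∷ r) = zero ∷ map suc (members r)
members (outside ∷ r) = map suc (members r)

∈ˢ⇔∈-members : (r : Subset n) {j : Fin n} → j ∈ˢ r ⇔ j ∈ members r
∈ˢ⇔∈-members r = mk⇔ (to r) (from r)
  where
  to : (r : Subset n) {j : Fin n} → j ∈ˢ r → j ∈ members r
  to (inside ∷ r) Vec.here = here refl
  to (inside ∷ r) (Vec.there j∈r) = there (∈-map⁺ suc (to r j∈r))
  to (outside ∷ r) (Vec.there j∈r) = ∈-map⁺ suc (to r j∈r)
  from : (r : Subset n) {j : Fin n} → j ∈ members r → j ∈ˢ r
  from (inside ∷ r) (here refl) = Vec.here
  from (inside ∷ r) (there j∈) with ∈-map⁻ suc j∈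
  ... | _ , j∈r , refl = Vec.there (from r j∈r)
  from (outside ∷ r) j∈ with ∈-map⁻ suc j∈
  ... | _ , j∈r , refl = Vec.there (from r j∈r)

length-members : (r : Subset n) → length (members r) ≡ ∣ r ∣
length-members [] = refl
length-members (inside ∷ r) = cong suc (trans (ListP.length-map suc (members r)) (length-members r))
length-members (outside ∷ r) = trans (ListP.length-map suc (members r)) (length-members r)

members-increasing : (r : Subset n) → AllPairs Fin._<_ (members r)
members-increasing [] = []
members-increasing (inside ∷ r) =
  AllP.map⁺ (All.universal (λ _ → ℕ.s≤s ℕ.z≤n) (members r))
  ∷ AllPairsP.map⁺ (AllPairs.map ℕ.s≤s (members-increasing r))
members-increasing (outside ∷ r) = AllPairsP.map⁺ (AllPairs.map ℕ.s≤s (members-increasing r))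

elements : Grid a b → List (Elem a b)
elements [] = []
elements (r ∷ S) = map (zero ,_) (members r) ++ map (Product.map₁ suc) (elements S)

∈G⇔∈-elements : (S : Grid a b) {x : Elem a b} → x ∈G S ⇔ x ∈ elements S
∈G⇔∈-elements S = mk⇔ (to S _) (from S)
  where
  to : (S : Grid a b) (x : Elem a b) → x ∈G S → x ∈ elements S
  to (r ∷ S) (zero , j) j∈r = ∈-++⁺ˡ (∈-map⁺ (zero ,_) (Equivalence.to (∈ˢ⇔∈-members r) j∈r))
  to (r ∷ S) (suc i , j) x∈S = ∈-++⁺ʳ (map (zero ,_) (members r)) (∈-map⁺ _ (to S (i , j) x∈S))
  from : (S : Grid a b) {x : Elem a b} → x ∈ elements S → x ∈G S
  from (r ∷ S) x∈ with ∈-++⁻ (map (zero ,_) (members r)) x∈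
  ... | inj₁ x∈row with ∈-map⁻ (zero ,_) x∈row
  ...   | _ , j∈r , refl = Equivalence.from (∈ˢ⇔∈-members r) j∈r
  from (r ∷ S) x∈ | inj₂ x∈rest with ∈-map⁻ (Product.map₁ suc) x∈rest
  ...   | _ , x∈S , refl = from S x∈S

length-elements : (S : Grid a b) → length (elements S) ≡ card S
length-elements [] = refl
length-elements (r ∷ S) = begin
  length (map (zero ,_) (members r) ++ map (Product.map₁ suc) (elements S))
    ≡⟨ ListP.length-++ (map (zero ,_) (members r)) ⟩
  length (map (zero ,_) (members r)) + length (map (Product.map₁ suc) (elements S))
    ≡⟨ cong₂ _+_ (ListP.length-map _ (members r)) (ListP.length-map _ (elements S)) ⟩
  length (members r) + length (elements S)
    ≡⟨ cong₂ _+_ (length-members r) (length-elements S) ⟩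
  ∣ r ∣ + card S ∎
  where open ≡-Reasoning

_<ₗₑₓ_ : Rel (Elem a b) _
_<ₗₑₓ_ = ×-Lex _≡_ Fin._<_ Fin._<_

elements-lex-increasing : (S : Grid a b) → AllPairs _<ₗₑₓ_ (elements S)
elements-lex-increasing [] = []
elements-lex-increasing (r ∷ S) =
  AllPairsP.++⁺
    (AllPairsP.map⁺ (AllPairs.map (λ j<j' → inj₂ (refl , j<j')) (members-increasing r)))
    (AllPairsP.map⁺ (AllPairs.map suc-lex (elements-lex-increasing S)))
    (AllP.map⁺ (All.universal (λ _ → AllP.map⁺ (All.universal (λ _ → inj₁ (ℕ.s≤s ℕ.z≤n)) _)) _))
  where
  suc-lex : ∀ {x y : Elem _ _} → x <ₗₑₓ y → Product.map₁ suc x <ₗₑₓ Product.map₁ suc y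
  suc-lex (inj₁ i<i') = inj₁ (ℕ.s≤s i<i')
  suc-lex (inj₂ (refl , j<j')) = inj₂ (refl , j<j')

elements-sorted : (S : Grid a b) → IsAntichain S → Sorted (elements S)
elements-sorted S anti = AllPairs-map-∈ lex⇒⋖ (elements-lex-increasing S)
  where
  open Equivalence
  anti′ : ∀ {x y} → x ∈ elements S → y ∈ elements S → x ≤P y → x ≡ y
  anti′ x∈ y∈ = anti _ _ (from (∈G⇔∈-elements S) x∈) (from (∈G⇔∈-elements S) y∈)
  lex⇒⋖ : ∀ {x y} → x ∈ elements S → y ∈ elements S → x <ₗₑₓ y → x ⋖ y
  lex⇒⋖ {x} {y} x∈ y∈ (inj₁ i<i') with proj₂ y Fin.<? proj₂ x
  ... | yes j'<j = i<i' , j'<j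
  ... | no j'≮j =
    ⊥-elim (FinP.<-irrefl (cong proj₁ (anti′ x∈ y∈ (ℕP.<⇒≤ i<i' , ℕP.≮⇒≥ j'≮j))) i<i')
  lex⇒⋖ x∈ y∈ (inj₂ (refl , j<j')) =
    ⊥-elim (FinP.<-irrefl (cong proj₂ (anti′ x∈ y∈ (FinP.≤-refl , ℕP.<⇒≤ j<j'))) j<j')

_∈ᴱ?_ : (x : Elem a b) (l : List (Elem a b)) → Dec (x ∈ l)
x ∈ᴱ? l = Any.any? (x ≟ᴱ_) l

gridOf : List (Elem a b) → Grid a b
gridOf l = tabulate λ i → tabulate λ j → does ((i , j) ∈ᴱ? l)

∈⇔∈G-gridOf : (l : List (Elem a b)) {x : Elem a b} → x ∈ l ⇔ x ∈G gridOf l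
∈⇔∈G-gridOf l {i , j} = mk⇔ to from
  where
  lookup-gridOf : lookup (lookup (gridOf l) i) j ≡ does ((i , j) ∈ᴱ? l)
  lookup-gridOf = trans (cong (λ r → lookup r j) (VecP.lookup∘tabulate _ i)) (VecP.lookup∘tabulate _ j)
  to : (i , j) ∈ l → (i , j) ∈G gridOf l
  to x∈l = VecP.lookup⇒[]= j _ (trans lookup-gridOf (dec-true ((i , j) ∈ᴱ? l) x∈l))
  from : (i , j) ∈G gridOf l → (i , j) ∈ l
  from x∈G with (i , j) ∈ᴱ? l | trans (sym lookup-gridOf) (VecP.[]=⇒lookup x∈G)
  ... | yes x∈l | _ = x∈l
  ... | no _ | ()

gridOf-antichain : Sorted l → IsAntichain (gridOf l)
gridOf-antichain {l = l} s x y x∈ y∈ (i≤i' , j≤j')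
  with Sorted-trichotomous s (from (∈⇔∈G-gridOf l) x∈) (from (∈⇔∈G-gridOf l) y∈)
  where open Equivalence
... | inj₁ x≡y = x≡y
... | inj₂ (inj₁ (_ , j'<j)) = ⊥-elim (ℕP.<⇒≱ j'<j j≤j')
... | inj₂ (inj₂ (i'<i , _)) = ⊥-elim (ℕP.<⇒≱ i'<i i≤i')

grid-ext : {S T : Grid a b} → (∀ {x} → x ∈G S ⇔ x ∈G T) → S ≡ T
grid-ext {S = S} {T} S⇔T = begin
  S                   ≡⟨ VecP.tabulate∘lookup S ⟨
  tabulate (lookup S) ≡⟨ VecP.tabulate-cong (λ i → SubsetP.⊆-antisym (to S⇔T) (from S⇔T)) ⟩
  tabulate (lookup T) ≡⟨ VecP.tabulate∘lookup T ⟩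
  T                   ∎
  where
  open ≡-Reasoning
  open Equivalence

gridOf-elements : (S : Grid a b) → gridOf (elements S) ≡ S
gridOf-elements S = grid-ext (⇔-trans (⇔-sym (∈⇔∈G-gridOf (elements S))) (⇔-sym (∈G⇔∈-elements S)))

elements-gridOf : Sorted l → elements (gridOf l) ≡ l
elements-gridOf {l = l} s =
  AllPairs-≡ ⋖-trans ⋖-irrefl (elements-sorted (gridOf l) (gridOf-antichain s)) s
    (from (∈⇔∈G-gridOf l) ∘ from (∈G⇔∈-elements (gridOf l)))
    (to (∈G⇔∈-elements (gridOf l)) ∘ to (∈⇔∈G-gridOf l))
  where open Equivalence

-- Antichains as staircases

staircase : Antichain k a b → List (Elem a b)
staircase A = elements (set A)

staircase-sorted : (A : Antichain k a b) → Sorted (staircase A)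
staircase-sorted (mkAC S anti _) = recompute (AllPairs.allPairs? _⋖?_ (elements S)) (elements-sorted S anti)

length-staircase : (A : Antichain k a b) → length (staircase A) ≡ k
length-staircase (mkAC S _ size) = recompute (length (elements S) ℕ.≟ _) (trans (length-elements S) size)

antichainOf : (l : List (Elem a b)) → .(Sorted l) → .(length l ≡ k) → Antichain k a b
antichainOf l s e = mkAC (gridOf l) (gridOf-antichain s)
  (trans (sym (length-elements (gridOf l))) (trans (cong length (elements-gridOf s)) e))

set-injective : {A B : Antichain k a b} → set A ≡ set B → A ≡ B
set-injective {A = mkAC _ _ _} {mkAC _ _ _} refl = refl

antichainOf-staircase : (A : Antichain k a b) →
                        antichainOf (staircase A) (staircase-sorted A) (length-staircase A) ≡ A
antichainOf-staircase A = set-injective (gridOf-elements (set A))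

staircase-antichainOf : (s : Sorted l) .(e : length l ≡ k) → staircase (antichainOf l s e) ≡ l
staircase-antichainOf s _ = elements-gridOf s

≺⇒Replace : {A B : Antichain k a b} → A ≺ B →
            ∃₂ λ p q → p <P q × Replace (staircase A) (staircase B) p q
≺⇒Replace {A = A} {B} (p , q , p<q , ex) =
  p , q , p<q , Exchange⇒Replace (staircase-sorted A) (staircase-sorted B) p<q
                  (Exchange-resp (λ _ → ∈G⇔∈-elements (set A)) (λ _ → ∈G⇔∈-elements (set B)) ex)

Replace⇒≺ : (s : Sorted l) (s' : Sorted l') .(e : length l ≡ k) .(e' : length l' ≡ k) →
            p <P q → Replace l l' p q → antichainOf l s e ≺ antichainOf l' s' e'
Replace⇒≺ {l = l} {l'} s s' _ _ p<q@(_ , p≢q) r =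
  _ , _ , p<q ,
  Exchange-resp (λ _ → ∈⇔∈G-gridOf l) (λ _ → ∈⇔∈G-gridOf l')
    (Replace-Exchange (Replace-∉ ⋖-irrefl s p≢q r)
                      (Replace-∉ ⋖-irrefl s' (p≢q ∘ sym) (Replace-sym r)) r)

≤A⇒Pointwise : {A B : Antichain k a b} → A ≤A B → Pointwise _≤P_ (staircase A) (staircase B)
≤A⇒Pointwise ε = PointwiseP.refl ≤P-refl
≤A⇒Pointwise {A = A} (_◅_ {j = C} A≺C C≤B) with ≺⇒Replace {A = A} {C} A≺C
... | _ , _ , (p≤q , _) , r =
  PointwiseP.transitive ≤P-trans (Replace-pointwise ≤P-refl p≤q r) (≤A⇒Pointwise C≤B)

weight : List (Elem a b) → ℕ
weight [] = 0
weight (x ∷ l) = toℕ (proj₁ x) + toℕ (proj₂ x) + weight l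

weight-mono : Pointwise _≤P_ l l' → weight l ≤ weight l'
weight-mono [] = ℕ.z≤n
weight-mono ((i≤i' , j≤j') ∷ l≤l') = ℕP.+-mono-≤ (ℕP.+-mono-≤ i≤i' j≤j') (weight-mono l≤l')

data Progress (l l' : List (Elem a b)) : Set where
  arrived : l ≡ l' → Progress l l'
  moved : ∀ {m p q} → Sorted m → p <P q → Replace l m p q → Pointwise _≤P_ m l' →
          weight l < weight m → Progress l l'

-- Raise the head's column first (that keeps it ahead of the tail), then let the tail arrive,
-- and only then raise the head's row.
progress : Sorted l → Sorted l' → Pointwise _≤P_ l l' → Progress l l'
progress [] [] [] = arrived refl
progress {l = (i , j) ∷ t} {(i' , j') ∷ t'} (x⋖t ∷ st) (x'⋖t' ∷ st') ((i≤i' , j≤j') ∷ t≤t')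
  with j Fin.≟ j'
... | no j≢j' =
  moved (All.map (λ (i<u , u<j) → i<u , ℕP.<-≤-trans u<j j≤j') x⋖t ∷ st)
        ((FinP.≤-refl , j≤j') , j≢j' ∘ cong proj₂) here ((i≤i' , FinP.≤-refl) ∷ t≤t')
        (ℕP.+-monoˡ-< (weight t) (ℕP.+-monoʳ-< (toℕ i) (FinP.≤∧≢⇒< j≤j' j≢j')))
... | yes refl with progress st st' t≤t'
...   | moved sm p<q r m≤t' w< =
  moved (All-between between (Replace-pointwise ≤P-refl (proj₁ p<q) r) m≤t' x⋖t x'⋖t' ∷ sm)
        p<q ((i , j) ∷ r) ((i≤i' , j≤j') ∷ m≤t') (ℕP.+-monoʳ-< (toℕ i + toℕ j) w<)
  where
  between : ∀ {u v w} → u ≤P v → v ≤P w → (i , j) ⋖ u → (i' , j) ⋖ w → (i , j) ⋖ v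
  between (u₁≤v₁ , _) (_ , v₂≤w₂) (i<u₁ , _) (_ , w₂<j) =
    ℕP.<-≤-trans i<u₁ u₁≤v₁ , ℕP.≤-<-trans v₂≤w₂ w₂<j
...   | arrived refl with i Fin.≟ i'
...     | yes refl = arrived refl
...     | no i≢i' =
  moved (x'⋖t' ∷ st') ((i≤i' , FinP.≤-refl) , i≢i' ∘ cong proj₁) here (PointwiseP.refl ≤P-refl)
        (ℕP.+-monoˡ-< (weight t) (ℕP.+-monoˡ-< (toℕ j) (FinP.≤∧≢⇒< i≤i' i≢i')))

Pointwise⇒≤A : ∀ budget (s : Sorted l) (s' : Sorted l') (e : length l ≡ k) .(e' : length l' ≡ k) →
               Pointwise _≤P_ l l' → weight l' ≤ budget + weight l →
               antichainOf l s e ≤A antichainOf l' s' e'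
Pointwise⇒≤A budget s s' e e' l≤l' w≤ with progress s s' l≤l'
... | arrived refl = ε
... | moved sm p<q r m≤l' w< with budget
...   | zero = ⊥-elim (ℕP.<-irrefl refl (ℕP.<-≤-trans w< (ℕP.≤-trans (weight-mono m≤l') w≤)))
...   | suc budget = Replace⇒≺ s sm e e-m p<q r ◅ Pointwise⇒≤A budget sm s' e-m e' m≤l' w≤'
  where
  e-m = trans (sym (Replace-length r)) e
  w≤' = ℕP.≤-trans w≤ (ℕP.≤-trans (ℕP.≤-reflexive (sym (ℕP.+-suc budget _)))
                                    (ℕP.+-monoʳ-≤ budget w<))

≤A⇔Pointwise : {A B : Antichain k a b} → A ≤A B ⇔ Pointwise _≤P_ (staircase A) (staircase B)
≤A⇔Pointwise {A = A} {B} = mk⇔ ≤A⇒Pointwise λ A≤B →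
  subst₂ _≤A_ (antichainOf-staircase A) (antichainOf-staircase B)
    (Pointwise⇒≤A _ (staircase-sorted A) (staircase-sorted B) (length-staircase A) (length-staircase B)
                  A≤B (ℕP.m≤m+n _ _))

-- Staircases as pairs of combinations

combOf : (xs : List (Fin n)) → .(AllPairs Fin._<_ xs) → .(length xs ≡ k) → Comb n k
combOf xs s e = mkC (Vec.cast e (Vec.fromList xs))
  (Equivalence.from (AllPairs-toList⇔ _)
    (subst (AllPairs Fin._<_) (sym (trans (VecP.toList-cast e _) (VecP.toList∘fromList xs))) s))

toList-combOf : (xs : List (Fin n)) .(s : AllPairs Fin._<_ xs) .(e : length xs ≡ k) →
                toList (seq (combOf xs s e)) ≡ xs
toList-combOf xs _ e = trans (VecP.toList-cast e _) (VecP.toList∘fromList xs)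

seq-increasing : (c : Comb n k) → AllPairs Fin._<_ (toList (seq c))
seq-increasing (mkC v incr) =
  recompute (AllPairs.allPairs? Fin._<?_ (toList v)) (Equivalence.to (AllPairs-toList⇔ v) incr)

toList∘seq-injective : {c c' : Comb n k} → toList (seq c) ≡ toList (seq c') → c ≡ c'
toList∘seq-injective {c = mkC v _} {mkC w _} eq
  with trans (sym (VecP.cast-is-id refl v)) (VecP.toList-injective refl v w eq)
... | refl = refl

≤C⇔Pointwise : (c c' : Comb n k) {xs ys : List (Fin n)} →
               toList (seq c) ≡ xs → toList (seq c') ≡ ys →
               c ≤C c' ⇔ Pointwise Fin._≤_ xs ys
≤C⇔Pointwise c c' refl refl = Pointwise-toList⇔ (seq c) (seq c')

rows-increasing : Sorted l → AllPairs Fin._<_ (map proj₁ l)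
rows-increasing s = proj₁ (Equivalence.to (AllPairs-×⇔ {R = Fin._<_} {S = flip Fin._<_}) s)

cols-increasing : Sorted l → AllPairs Fin._<_ (reverse (map proj₂ l))
cols-increasing s =
  AllPairs-reverse⁺ (proj₂ (Equivalence.to (AllPairs-×⇔ {R = Fin._<_} {S = flip Fin._<_}) s))

length-rows : (l : List (Elem a b)) → length l ≡ k → length (map proj₁ l) ≡ k
length-rows l e = trans (ListP.length-map _ l) e

length-cols : (l : List (Elem a b)) → length l ≡ k → length (reverse (map proj₂ l)) ≡ k
length-cols l e = trans (ListP.length-reverse (map proj₂ l)) (trans (ListP.length-map _ l) e)

combsOf : (l : List (Elem a b)) → .(Sorted l) → .(length l ≡ k) → Comb a k × Comb b k
combsOf l s e = combOf (map proj₁ l) (rows-increasing s) (length-rows l e) ,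
                combOf (reverse (map proj₂ l)) (cols-increasing s) (length-cols l e)

zipCombs : Comb a k × Comb b k → List (Elem a b)
zipCombs (x , y) = zip (toList (seq x)) (reverse (toList (seq y)))

private
  map-proj-zipCombs : (c : Comb a k × Comb b k) →
    map proj₁ (zipCombs c) ≡ toList (seq (proj₁ c)) ×
    map proj₂ (zipCombs c) ≡ reverse (toList (seq (proj₂ c)))
  map-proj-zipCombs (x , y) = map-proj-zip (toList (seq x)) (reverse (toList (seq y))) (begin
    length (toList (seq x))           ≡⟨ VecP.length-toList (seq x) ⟩
    _                                 ≡⟨ VecP.length-toList (seq y) ⟨
    length (toList (seq y))           ≡⟨ ListP.length-reverse (toList (seq y)) ⟨
    length (reverse (toList (seq y))) ∎)
    where open ≡-Reasoning

zipCombs-sorted : (c : Comb a k × Comb b k) → Sorted (zipCombs c)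
zipCombs-sorted c@(x , y) with map-proj-zipCombs c
... | rows , cols = Equivalence.from (AllPairs-×⇔ {R = Fin._<_} {S = flip Fin._<_})
  ( subst (AllPairs Fin._<_) (sym rows) (seq-increasing x)
  , subst (AllPairs (flip Fin._<_)) (sym cols) (AllPairs-reverse⁺ {R = flip Fin._<_} (seq-increasing y)))

length-zipCombs : (c : Comb a k × Comb b k) → length (zipCombs c) ≡ k
length-zipCombs c@(x , _) =
  trans (sym (ListP.length-map proj₁ (zipCombs c)))
        (trans (cong length (proj₁ (map-proj-zipCombs c))) (VecP.length-toList (seq x)))

zipCombs-combsOf : (l : List (Elem a b)) (s : Sorted l) .(e : length l ≡ k) → zipCombs (combsOf l s e) ≡ l
zipCombs-combsOf l s e = begin
  zipCombs (combsOf l s e)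
    ≡⟨ cong₂ (λ xs ys → zip xs (reverse ys)) (toList-combOf _ (rows-increasing s) (length-rows l e))
                                              (toList-combOf _ (cols-increasing s) (length-cols l e)) ⟩
  zip (map proj₁ l) (reverse (reverse (map proj₂ l)))
    ≡⟨ cong (zip (map proj₁ l)) (ListP.reverse-involutive (map proj₂ l)) ⟩
  zip (map proj₁ l) (map proj₂ l)
    ≡⟨ zip-map-proj l ⟩
  l ∎
  where open ≡-Reasoning

combsOf-zipCombs : (c : Comb a k × Comb b k) →
                   combsOf (zipCombs c) (zipCombs-sorted c) (length-zipCombs c) ≡ c
combsOf-zipCombs c = cong₂ _,_
  (toList∘seq-injective (trans (toList-combOf _ (rows-increasing s) (length-rows (zipCombs c) e)) rows))
  (toList∘seq-injective (trans (toList-combOf _ (cols-increasing s) (length-cols (zipCombs c) e))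
                 (trans (cong reverse cols) (ListP.reverse-involutive _))))
  where
  s = zipCombs-sorted c
  e = length-zipCombs c
  rows = proj₁ (map-proj-zipCombs c)
  cols = proj₂ (map-proj-zipCombs c)

combsOf-≤CC⇔ : (s : Sorted l) (s' : Sorted l') .(e : length l ≡ k) .(e' : length l' ≡ k) →
               combsOf l s e ≤CC combsOf l' s' e' ⇔ Pointwise _≤P_ l l'
combsOf-≤CC⇔ {l = l} {l'} s s' e e' =
  ⇔-trans (rows ×-⇔ cols) (⇔-sym (Pointwise-×⇔ {R = Fin._≤_} {S = Fin._≤_}))
  where
  rows : proj₁ (combsOf l s e) ≤C proj₁ (combsOf l' s' e') ⇔
         Pointwise Fin._≤_ (map proj₁ l) (map proj₁ l')
  rows = ≤C⇔Pointwise (proj₁ (combsOf l s e)) (proj₁ (combsOf l' s' e'))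
                      (toList-combOf _ (rows-increasing s) (length-rows l e))
                      (toList-combOf _ (rows-increasing s') (length-rows l' e'))
  cols : proj₂ (combsOf l s e) ≤C proj₂ (combsOf l' s' e') ⇔
         Pointwise Fin._≤_ (map proj₂ l) (map proj₂ l')
  cols = ⇔-trans (≤C⇔Pointwise (proj₂ (combsOf l s e)) (proj₂ (combsOf l' s' e'))
                                (toList-combOf _ (cols-increasing s) (length-cols l e))
                                (toList-combOf _ (cols-increasing s') (length-cols l' e')))
                 Pointwise-reverse⇔

combsOf-cong : (s : Sorted l) .(e : length l ≡ k) (eq : l ≡ l') →
               combsOf l s e ≡ combsOf l' (subst Sorted eq s) (trans (cong length (sym eq)) e)
combsOf-cong s e refl = refl

antichainOf-cong : (s : Sorted l) .(e : length l ≡ k) (eq : l ≡ l') →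
                   antichainOf l s e ≡ antichainOf l' (subst Sorted eq s) (trans (cong length (sym eq)) e)
antichainOf-cong s e refl = refl

toCombs : Antichain k a b → Comb a k × Comb b k
toCombs A = combsOf (staircase A) (staircase-sorted A) (length-staircase A)

fromCombs : Comb a k × Comb b k → Antichain k a b
fromCombs c = antichainOf (zipCombs c) (zipCombs-sorted c) (length-zipCombs c)

toCombs∘fromCombs : (c : Comb a k × Comb b k) → toCombs (fromCombs c) ≡ c
toCombs∘fromCombs c =
  trans (combsOf-cong (staircase-sorted (fromCombs c)) (length-staircase (fromCombs c))
                      (staircase-antichainOf (zipCombs-sorted c) (length-zipCombs c)))
        (combsOf-zipCombs c)

fromCombs∘toCombs : (A : Antichain k a b) → fromCombs (toCombs A) ≡ A
fromCombs∘toCombs A =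
  trans (antichainOf-cong (zipCombs-sorted (toCombs A)) (length-zipCombs (toCombs A))
                          (zipCombs-combsOf (staircase A) (staircase-sorted A) (length-staircase A)))
        (antichainOf-staircase A)

≤A⇔≤CC-toCombs : {A B : Antichain k a b} → A ≤A B ⇔ toCombs A ≤CC toCombs B
≤A⇔≤CC-toCombs {A = A} {B} =
  ⇔-trans ≤A⇔Pointwise
    (⇔-sym (combsOf-≤CC⇔ (staircase-sorted A) (staircase-sorted B)
                         (length-staircase A) (length-staircase B)))

proposition3p1 : ∀ (a b k : ℕ) → k ≤ a → k ≤ b →
    OrderIso (Antichain k a b) (Comb a k × Comb b k) _≤A_ _≤CC_
proposition3p1 a b k _ _ =
  mk↔ₛ′ toCombs fromCombs toCombs∘fromCombs fromCombs∘toCombs , λ _ _ → ≤A⇔≤CC-toCombs
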